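{- Let $(a_n)_{n\ge1}$ be defined by $a_1=1$ and $a_n=a_{n-1}+a_{\lfloor n/2\rfloor}$ for $n>1$. If $n\in\mathbb{N}$ is odd, then $a_{4n}\equiv a_n+4\pmod 8$. -}

module Defs where

open import Data.Nat using (ℕ; zero; suc; _+_; _<_; _/_; s≤s; z≤n)
open import Data.Nat.Properties using (≤-refl)
open import Data.Nat.DivMod using (m/n<m)
open import Data.Nat.Induction using (<-rec)

-- The value a 0 is an irrelevant convention (set
-- to 0); it is never used by the recurrence, since for n ≥ 2 both n ∸ 1 ≥ 1 and
-- ⌊n/2⌋ ≥ 1.
aStep : (n : ℕ) → ({m : ℕ} → m < n → ℕ) → ℕ
aStep zero _ = 0
aStep (suc zero) _ = 1
aStep (suc (suc k)) rec =
  rec {suc k} ≤-refl + rec {suc (suc k) / 2} (m/n<m (suc (suc k)) 2 (s≤s (s≤s z≤n)))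

a : ℕ → ℕ
a = <-rec (λ _ → ℕ) aStep

-- Unfolding the recurrence four times around 4n shows
--   a (4n + 4) + a n = a (4n) + 4 a (2n + 1) + a (n + 1),
-- and a (2n + 1) is always odd (a (2k + 3) = a (2k + 1) + 2 a (k + 1)), so
-- 4 a (2n + 1) ≡ 4 (mod 8). Induction on n then gives a (4n) ≡ a n + 4n (mod 8),
-- and 4n ≡ 4 (mod 8) for odd n.
module Submission where

open import Defs
open import Data.Nat using (ℕ; zero; suc; _+_; _*_; _%_; _/_; _<_; s≤s; z≤n)
open import Data.Nat.DivMod using (+-distrib-/; m*n/n≡m; m*n%n≡0; m/n≡1+[m∸n]/n; m≡m%n+[m/n]*n; [m+kn]%n≡m%n)
open import Data.Nat.Induction using (<-wellFounded)
open import Data.Nat.Properties using (+-cancelʳ-≡)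
open import Data.Nat.Tactic.RingSolver using (solve-∀)
open import Data.Product using (∃-syntax; _,_)
open import Induction.WellFounded using (module FixPoint)
open import Relation.Binary.PropositionalEquality using (_≡_; refl; sym; trans; cong; cong₂; subst; module ≡-Reasoning)

open ≡-Reasoning

aStep-cong : ∀ n {rec rec′ : {m : ℕ} → m < n → ℕ} →
             (∀ {m} (m<n : m < n) → rec m<n ≡ rec′ m<n) → aStep n rec ≡ aStep n rec′
aStep-cong zero          _  = refl
aStep-cong (suc zero)    _  = refl
aStep-cong (suc (suc n)) eq = cong₂ _+_ (eq _) (eq _)

a-unfold : ∀ n → a (2 + n) ≡ a (1 + n) + a ((2 + n) / 2)
a-unfold n = FixPoint.unfold-wfRec <-wellFounded (λ _ → ℕ) aStep aStep-cong {2 + n}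

suc[m*2]/2≡m : ∀ m → suc (m * 2) / 2 ≡ m
suc[m*2]/2≡m m = trans (+-distrib-/ 1 (m * 2) no-carry) (m*n/n≡m m 2)
  where
  no-carry : 1 % 2 + m * 2 % 2 < 2
  no-carry = subst (λ r → 1 + r < 2) (sym (m*n%n≡0 m 2)) (s≤s (s≤s z≤n))

a-even-index : ∀ k → a (suc k * 2) ≡ a (1 + k * 2) + a (suc k)
a-even-index k = trans (a-unfold (k * 2)) (cong (λ i → a (1 + k * 2) + a i) (m*n/n≡m (suc k) 2))

a-odd-index : ∀ k → a (1 + suc k * 2) ≡ a (suc k * 2) + a (suc k)
a-odd-index k = trans (a-unfold (1 + k * 2)) (cong (λ i → a (suc k * 2) + a i) half)
  where
  half : (1 + suc k * 2) / 2 ≡ suc k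
  half = trans (m/n≡1+[m∸n]/n {1 + suc k * 2} (s≤s (s≤s z≤n))) (cong suc (suc[m*2]/2≡m k))

a-odd-index-step : ∀ k → a (1 + suc k * 2) ≡ a (1 + k * 2) + 2 * a (suc k)
a-odd-index-step k = begin
  a (1 + suc k * 2)                     ≡⟨ a-odd-index k ⟩
  a (suc k * 2) + a (suc k)             ≡⟨ cong (_+ a (suc k)) (a-even-index k) ⟩
  a (1 + k * 2) + a (suc k) + a (suc k) ≡⟨ x+y+y≡x+2y (a (1 + k * 2)) (a (suc k)) ⟩
  a (1 + k * 2) + 2 * a (suc k)         ∎
  where
  x+y+y≡x+2y : ∀ x y → x + y + y ≡ x + 2 * y
  x+y+y≡x+2y = solve-∀

a-odd-index-odd : ∀ k → ∃[ x ] a (1 + k * 2) ≡ 1 + x * 2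
a-odd-index-odd zero = 0 , refl
a-odd-index-odd (suc k) with x , eq ← a-odd-index-odd k = x + a (suc k) , (begin
  a (1 + suc k * 2)             ≡⟨ a-odd-index-step k ⟩
  a (1 + k * 2) + 2 * a (suc k) ≡⟨ cong (_+ 2 * a (suc k)) eq ⟩
  1 + x * 2 + 2 * a (suc k)     ≡⟨ regroup x (a (suc k)) ⟩
  1 + (x + a (suc k)) * 2       ∎)
  where
  regroup : ∀ x y → 1 + x * 2 + 2 * y ≡ 1 + (x + y) * 2
  regroup = solve-∀

-- The case n = 0 holds by computation only: a 1 ≠ a 0 + a 0.
a-4n-step : ∀ n → a (4 * suc n) + a n ≡ a (4 * n) + 4 * a (1 + n * 2) + a (suc n)
a-4n-step zero    = refl
a-4n-step (suc m) = begin
  a (4 * suc n) + a n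
    ≡⟨ cong (λ i → a i + a n) (4*suc[n]≡suc[1+n*2]*2 n) ⟩
  a (suc (1 + n * 2) * 2) + a n
    ≡⟨ cong (_+ a n) (a-even-index (1 + n * 2)) ⟩
  a (1 + suc (n * 2) * 2) + a (suc n * 2) + a n
    ≡⟨ cong₂ (λ u v → u + v + a n) (a-odd-index-step (n * 2)) (a-even-index n) ⟩
  a (1 + n * 2 * 2) + 2 * y + (y + a (suc n)) + a n
    ≡⟨ cong (λ u → u + 2 * y + (y + a (suc n)) + a n) (a-odd-index (suc (m * 2))) ⟩
  a (n * 2 * 2) + a (n * 2) + 2 * y + (y + a (suc n)) + a n
    ≡⟨ regroup (a (n * 2 * 2)) (a (n * 2)) y (a (suc n)) (a n) ⟩
  a (n * 2 * 2) + (a (n * 2) + a n + 3 * y) + a (suc n)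
    ≡⟨ cong (λ u → a (n * 2 * 2) + (u + 3 * y) + a (suc n)) (sym (a-odd-index m)) ⟩
  a (n * 2 * 2) + (y + 3 * y) + a (suc n)
    ≡⟨ cong₂ (λ i u → a i + u + a (suc n)) (n*2*2≡4*n n) (y+3*y≡4*y y) ⟩
  a (4 * n) + 4 * y + a (suc n) ∎
  where
  n = suc m
  y = a (1 + n * 2)
  4*suc[n]≡suc[1+n*2]*2 : ∀ n → 4 * suc n ≡ suc (1 + n * 2) * 2
  4*suc[n]≡suc[1+n*2]*2 = solve-∀
  regroup : ∀ p q y r s → p + q + 2 * y + (y + r) + s ≡ p + (q + s + 3 * y) + r
  regroup = solve-∀
  n*2*2≡4*n : ∀ n → n * 2 * 2 ≡ 4 * n
  n*2*2≡4*n = solve-∀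
  y+3*y≡4*y : ∀ y → y + 3 * y ≡ 4 * y
  y+3*y≡4*y = solve-∀

a-4n-mod-8 : ∀ n → ∃[ q ] a (4 * n) ≡ a n + 4 * n + q * 8
a-4n-mod-8 zero = 0 , refl
a-4n-mod-8 (suc n) with q , eq ← a-4n-mod-8 n | x , ex ← a-odd-index-odd n =
  q + x , +-cancelʳ-≡ (a n) _ _ (begin
    a (4 * suc n) + a n
      ≡⟨ a-4n-step n ⟩
    a (4 * n) + 4 * a (1 + n * 2) + a (suc n)
      ≡⟨ cong₂ (λ u v → u + 4 * v + a (suc n)) eq ex ⟩
    a n + 4 * n + q * 8 + 4 * (1 + x * 2) + a (suc n)
      ≡⟨ regroup (a n) n q x (a (suc n)) ⟩
    a (suc n) + 4 * suc n + (q + x) * 8 + a n ∎)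
  where
  regroup : ∀ p n q x r → p + 4 * n + q * 8 + 4 * (1 + x * 2) + r ≡ r + 4 * suc n + (q + x) * 8 + p
  regroup = solve-∀

mainTheorem3 : (n : ℕ) → n % 2 ≡ 1 → a (4 * n) % 8 ≡ (a n + 4) % 8
mainTheorem3 n n-odd with q , eq ← a-4n-mod-8 n = begin
  a (4 * n) % 8                      ≡⟨ cong (_% 8) eq ⟩
  (a n + 4 * n + q * 8) % 8          ≡⟨ cong (λ m → (a n + 4 * m + q * 8) % 8) n≡1+k*2 ⟩
  (a n + 4 * (1 + k * 2) + q * 8) % 8 ≡⟨ cong (_% 8) (regroup (a n) k q) ⟩
  (a n + 4 + (k + q) * 8) % 8        ≡⟨ [m+kn]%n≡m%n (a n + 4) (k + q) 8 ⟩
  (a n + 4) % 8                      ∎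
  where
  k = n / 2
  n≡1+k*2 : n ≡ 1 + k * 2
  n≡1+k*2 = trans (m≡m%n+[m/n]*n n 2) (cong (_+ k * 2) n-odd)
  regroup : ∀ p k q → p + 4 * (1 + k * 2) + q * 8 ≡ p + 4 + (k + q) * 8
  regroup = solve-∀
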